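{- Let $r,s$ be positive integers with $r\geq s(s-1)$. Then the $(r\times s)$-dimensional grid $P_r\,\square\, P_s$ satisfies ${\rm ip}_{c}(P_r\,\square\, P_s)={\rm ip}_{p}(P_r\,\square\, P_s)=s$.
   Context: $P_d$ is the path on $d$ vertices and $\square$ the Cartesian product. A path is isometric if its length equals the distance between its endpoints; single vertices count as paths. ${\rm ip}_{c}(H)$ (resp. ${\rm ip}_{p}(H)$) is the minimum number of isometric paths of $H$ whose vertex sets cover (resp. partition) $V(H)$. -}

module Defs where

open import Level using (0ℓ)
open import Data.Nat using (ℕ; zero; suc; _≤_)
open import Data.Fin using (Fin; toℕ)
open import Data.Product using (_×_; _,_; ∃-syntax; Σ-syntax)
open import Data.Sum using (_⊎_)
open import Data.List using (List; []; _∷_; length)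
open import Data.List.Membership.Propositional using (_∈_)
open import Data.List.Relation.Unary.Linked using (Linked)
open import Data.List.Relation.Unary.Unique.Propositional using (Unique)
open import Relation.Binary.PropositionalEquality using (_≡_)

record Graph : Set₁ where
  field
    V   : Set
    Adj : V → V → Set
open Graph public

P : ℕ → Graph
P d = record { V = Fin d
             ; Adj = λ i j → (toℕ j ≡ suc (toℕ i)) ⊎ (toℕ i ≡ suc (toℕ j)) }

_□_ : Graph → Graph → Graph
G □ H = record
  { V = V G × V H
  ; Adj = λ { (g , h) (g' , h') →
              (Adj G g g' × h ≡ h') ⊎ (g ≡ g' × Adj H h h') } }

data Walk (G : Graph) : V G → V G → ℕ → Set where
  here : ∀ {u} → Walk G u u zero
  step : ∀ {u w v n} → Adj G u w → Walk G w v n → Walk G u v (suc n)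

endpoint : {A : Set} → A → List A → A
endpoint x []       = x
endpoint x (y ∷ ys) = endpoint y ys

-- x ∷ xs is a path: consecutive vertices adjacent, all vertices distinct.
-- Its length is the number of edges, length xs.
IsPath : (G : Graph) → V G → List (V G) → Set
IsPath G x xs = Linked (Adj G) (x ∷ xs) × Unique (x ∷ xs)

-- Isometric path: a path whose length equals the distance between its
-- endpoints, i.e. no walk between the endpoints is shorter than it.
-- (Single vertices, xs = [], are included.)
IsIsometricPath : (G : Graph) → V G → List (V G) → Set
IsIsometricPath G x xs =
  IsPath G x xs × (∀ n → Walk G x (endpoint x xs) n → length xs ≤ n)

record IsoPathFamily (G : Graph) (k : ℕ) : Set where
  field
    first : Fin k → V G
    rest  : Fin k → List (V G)
    iso   : ∀ i → IsIsometricPath G (first i) (rest i)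

  verts : Fin k → List (V G)
  verts i = first i ∷ rest i

open IsoPathFamily public

IsCover : (G : Graph) → {k : ℕ} → IsoPathFamily G k → Set
IsCover G {k} F = ∀ (v : V G) → ∃[ i ] (v ∈ verts F i)

IsPartition : (G : Graph) → {k : ℕ} → IsoPathFamily G k → Set
IsPartition G {k} F =
  IsCover G F × (∀ (i j : Fin k) (v : V G) → v ∈ verts F i → v ∈ verts F j → i ≡ j)

HasIsoCover : Graph → ℕ → Set
HasIsoCover G k = Σ[ F ∈ IsoPathFamily G k ] IsCover G {k} F

HasIsoPartition : Graph → ℕ → Set
HasIsoPartition G k = Σ[ F ∈ IsoPathFamily G k ] IsPartition G {k} F

ipc≡ : Graph → ℕ → Set
ipc≡ G k = HasIsoCover G k × (∀ m → HasIsoCover G m → k ≤ m)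

ipp≡ : Graph → ℕ → Set
ipp≡ G k = HasIsoPartition G k × (∀ m → HasIsoPartition G m → k ≤ m)

-- The s rows of the grid are isometric paths partitioning it, since a walk between the ends
-- of a row must advance r - 1 times in the first coordinate.  Conversely, the grid has
-- diameter r + s - 2, so an isometric path has at most r + s - 1 vertices and a cover by
-- m paths gives r s ≤ m (r + s - 1); for m ≤ s - 1 this contradicts s (s - 1) ≤ r.
module Submission where

open import Defs
open import Function using (id)
open import Data.Nat using (ℕ; zero; suc; _≤_; _<_; _*_; _∸_; _+_; z≤n; s≤s)
open import Data.Nat.Properties
open import Data.Nat.Tactic.RingSolver using (solve-∀)
open import Data.Product using (_×_; _,_; proj₁; proj₂; ∃-syntax; uncurry)
open import Data.Sum using (inj₁; inj₂)
import Data.Sum as Sum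
open import Data.Fin using (Fin; zero; suc; toℕ; inject₁; inject≤; combine; remQuot)
open import Data.Fin.Properties
  using (toℕ-inject₁; injective⇒≤; combine-injective; combine-remQuot; inject≤-injective)
open import Data.List using (List; []; _∷_; length; map; tabulate; allFin; lookup)
open import Data.List.Properties using (length-map)
open import Data.List.Relation.Unary.Linked as Linked using (Linked; []; [-]; _∷_)
open import Data.List.Relation.Unary.Linked.Properties as Linkedₚ using (Linked⇒AllPairs)
import Data.List.Relation.Unary.AllPairs as AllPairs
open import Data.List.Relation.Unary.Unique.Propositional using (Unique)
import Data.List.Relation.Unary.Unique.Propositional.Properties as Uniqueₚ
open import Data.List.Relation.Unary.Any using (index)
open import Data.List.Relation.Unary.Any.Properties using (lookup-index)
open import Data.List.Membership.Propositional using (_∈_)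
open import Data.List.Membership.Propositional.Properties using (∈-map⁺; ∈-map⁻; ∈-allFin)
open import Relation.Binary.PropositionalEquality

private
  variable
    A B : Set
    G H : Graph
    d m n D N : ℕ

Walk-++ : ∀ {u w v} → Walk G u w m → Walk G w v n → Walk G u v (m + n)
Walk-++ here       q = q
Walk-++ (step a p) q = step a (Walk-++ p q)

Walk-snoc : ∀ {u w v} → Walk G u w n → Adj G w v → Walk G u v (suc n)
Walk-snoc here       b = step b here
Walk-snoc (step a p) b = step a (Walk-snoc p b)

Walk-map : (f : V G → V H) → (∀ {u v} → Adj G u v → Adj H (f u) (f v)) →
           ∀ {u v} → Walk G u v n → Walk H (f u) (f v) n
Walk-map f f-adj here       = here
Walk-map f f-adj (step a p) = step (f-adj a) (Walk-map f f-adj p)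

endpoint-map : (f : A → B) (x : A) (xs : List A) → endpoint (f x) (map f xs) ≡ f (endpoint x xs)
endpoint-map f x []       = refl
endpoint-map f x (y ∷ ys) = endpoint-map f y ys

tabulate-linked : ∀ {R : A → A → Set} {f : Fin (suc n) → A} →
                  (∀ i → R (f (inject₁ i)) (f (suc i))) → Linked R (tabulate f)
tabulate-linked {n = zero}  R-step = [-]
tabulate-linked {n = suc n} {f = f} R-step =
  R-step zero ∷ tabulate-linked {f = λ i → f (suc i)} (λ i → R-step (suc i))

isometric-length≤ : (∀ u v → ∃[ n ] n ≤ D × Walk G u v n) →
                    ∀ {x xs} → IsIsometricPath G x xs → length xs ≤ D
isometric-length≤ connected {x} {xs} (_ , shortest) =
  let n , n≤D , w = connected x (endpoint x xs) in ≤-trans (shortest n w) n≤D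

cover-size : (F : IsoPathFamily G m) → IsCover G F → (∀ i → length (rest F i) ≤ D) →
             (ι : Fin N → V G) → (∀ {x y} → ι x ≡ ι y → x ≡ y) → N ≤ m * suc D
cover-size {m = m} {D = D} F cover short ι ι-injective =
  injective⇒≤ (λ {x} {y} e → ι-injective (code-injective (cover (ι x)) (cover (ι y)) e))
  where
    code : ∀ {v} → ∃[ i ] v ∈ verts F i → Fin (m * suc D)
    code (i , v∈) = combine i (inject≤ (index v∈) (s≤s (short i)))

    code-injective : ∀ {u v} (cu : ∃[ i ] u ∈ verts F i) (cv : ∃[ i ] v ∈ verts F i) →
                     code cu ≡ code cv → u ≡ v
    code-injective (i , u∈) (j , v∈) e with combine-injective i _ j _ e
    ... | refl , same-index = begin
      _                              ≡⟨ lookup-index u∈ ⟩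
      lookup (verts F i) (index u∈)  ≡⟨ cong (lookup (verts F i)) (inject≤-injective _ _ _ _ same-index) ⟩
      lookup (verts F i) (index v∈)  ≡⟨ lookup-index v∈ ⟨
      _                              ∎
      where open ≡-Reasoning

□-walk : ∀ {g g' h h'} → Walk G g g' m → Walk H h h' n → Walk (G □ H) (g , h) (g' , h') (m + n)
□-walk {g' = g'} {h = h} p q =
  Walk-++ (Walk-map (_, h) (λ a → inj₁ (a , refl)) p) (Walk-map (g' ,_) (λ a → inj₂ (refl , a)) q)

□-walk-proj₁ : ∀ {u v} → Walk (G □ H) u v n → ∃[ m ] m ≤ n × Walk G (proj₁ u) (proj₁ v) m
□-walk-proj₁ here = 0 , z≤n , here
□-walk-proj₁ (step (inj₁ (a , _)) w) =
  let m , m≤n , w′ = □-walk-proj₁ w in suc m , s≤s m≤n , step a w′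
□-walk-proj₁ {G = G} (step (inj₂ (same , _)) w) =
  let m , m≤n , w′ = □-walk-proj₁ w
  in m , m≤n⇒m≤1+n m≤n , subst (λ g → Walk G g _ m) (sym same) w′

□-row-isometric : ∀ {x xs} (h : V H) → IsIsometricPath G x xs →
                  IsIsometricPath (G □ H) (x , h) (map (_, h) xs)
□-row-isometric {H = H} {G = G} {x = x} {xs} h ((linked , unique) , shortest) =
  (Linkedₚ.map⁺ (Linked.map (λ a → inj₁ (a , refl)) linked) , Uniqueₚ.map⁺ (cong proj₁) unique) ,
  row-shortest
  where
    row-shortest : ∀ n → Walk (G □ H) (x , h) (endpoint (x , h) (map (_, h) xs)) n →
                   length (map (_, h) xs) ≤ n
    row-shortest n w rewrite length-map (_, h) xs | endpoint-map (_, h) x xs =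
      let m , m≤n , w′ = □-walk-proj₁ w in ≤-trans (shortest m w′) m≤n

□P-rows : ∀ {s x xs} → IsIsometricPath G x xs → (∀ g → g ∈ x ∷ xs) → HasIsoPartition (G □ P s) s
□P-rows {G = G} {s} {x} {xs} isometric spanning = rows , covering , disjoint
  where
    rows : IsoPathFamily (G □ P s) s
    rows = record { first = λ h → x , h ; rest = λ h → map (_, h) xs
                  ; iso = λ h → □-row-isometric h isometric }

    covering : IsCover (G □ P s) rows
    covering (g , h) = h , ∈-map⁺ (_, h) (spanning g)

    row-of : ∀ {v h} → v ∈ verts rows h → proj₂ v ≡ h
    row-of v∈ = let _ , _ , v≡ = ∈-map⁻ _ v∈ in cong proj₂ v≡

    disjoint : ∀ i j v → v ∈ verts rows i → v ∈ verts rows j → i ≡ j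
    disjoint i j v v∈i v∈j = trans (sym (row-of v∈i)) (row-of v∈j)

Ascending : Fin d → Fin d → Set
Ascending i j = toℕ j ≡ suc (toℕ i)

P-adj-suc : ∀ {i j : Fin d} → Adj (P d) i j → Adj (P (suc d)) (suc i) (suc j)
P-adj-suc = Sum.map (cong suc) (cong suc)

P-connected : ∀ (i j : Fin (suc d)) → ∃[ n ] n ≤ d × Walk (P (suc d)) i j n
P-connected zero zero = 0 , z≤n , here
P-connected {suc d} zero (suc j) =
  let n , n≤d , w = P-connected zero j
  in suc n , s≤s n≤d , step (inj₁ refl) (Walk-map suc P-adj-suc w)
P-connected {suc d} (suc i) zero =
  let n , n≤d , w = P-connected i zero
  in suc n , s≤s n≤d , Walk-snoc (Walk-map suc P-adj-suc w) (inj₂ refl)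
P-connected {suc d} (suc i) (suc j) =
  let n , n≤d , w = P-connected i j
  in n , m≤n⇒m≤1+n n≤d , Walk-map suc P-adj-suc w

P-walk-reach : ∀ {i j} → Walk (P d) i j n → toℕ j ≤ toℕ i + n
P-walk-reach {i = i} here = m≤m+n (toℕ i) 0
P-walk-reach {n = suc n} {i = i} (step a w) = begin
  _                 ≤⟨ P-walk-reach w ⟩
  toℕ _ + n         ≤⟨ +-monoˡ-≤ n (adj-reach a) ⟩
  suc (toℕ i) + n   ≡⟨ +-suc (toℕ i) n ⟨
  toℕ i + suc n     ∎
  where
    open ≤-Reasoning
    adj-reach : ∀ {i j : Fin d} → Adj (P d) i j → toℕ j ≤ suc (toℕ i)
    adj-reach (inj₁ up)   = ≤-reflexive up
    adj-reach (inj₂ down) = ≤-trans (n≤1+n _) (≤-trans (≤-reflexive (sym down)) (n≤1+n _))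

ascending-endpoint : ∀ {x} {xs : List (Fin d)} → Linked Ascending (x ∷ xs) →
                     toℕ (endpoint x xs) ≡ toℕ x + length xs
ascending-endpoint {x = x} {[]} [-] = sym (+-identityʳ (toℕ x))
ascending-endpoint {x = x} {y ∷ ys} (up ∷ linked) = begin
  toℕ (endpoint y ys)       ≡⟨ ascending-endpoint linked ⟩
  toℕ y + length ys         ≡⟨ cong (_+ length ys) up ⟩
  suc (toℕ x) + length ys   ≡⟨ +-suc (toℕ x) (length ys) ⟨
  toℕ x + length (y ∷ ys)   ∎
  where open ≡-Reasoning

P-ascending-isometric : ∀ {x} {xs : List (Fin d)} → Linked Ascending (x ∷ xs) →
                        IsIsometricPath (P d) x xs
P-ascending-isometric {d = d} {x = x} {xs} ascending = (Linked.map inj₁ ascending , distinct) , shortest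
  where
    distinct : Unique (x ∷ xs)
    distinct = AllPairs.map (λ lt eq → <-irrefl (cong toℕ eq) lt)
                 (Linked⇒AllPairs <-trans (Linked.map (λ up → ≤-reflexive (sym up)) ascending))

    shortest : ∀ n → Walk (P d) x (endpoint x xs) n → length xs ≤ n
    shortest n w = +-cancelˡ-≤ (toℕ x) _ _
      (subst (_≤ toℕ x + n) (ascending-endpoint ascending) (P-walk-reach w))

allFin-ascending : ∀ d → Linked (Ascending {d}) (allFin d)
allFin-ascending zero    = []
allFin-ascending (suc d) = tabulate-linked {f = id} (λ i → cong suc (sym (toℕ-inject₁ i)))

grid-connected : ∀ {a b} (u v : Fin (suc a) × Fin (suc b)) →
                 ∃[ n ] n ≤ a + b × Walk (P (suc a) □ P (suc b)) u v n
grid-connected (g , h) (g' , h') =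
  let m , m≤a , p = P-connected g g'
      n , n≤b , q = P-connected h h'
  in m + n , +-mono-≤ m≤a n≤b , □-walk p q

grid-isometric-length≤ : ∀ {a b x xs} → IsIsometricPath (P (suc a) □ P (suc b)) x xs →
                         length xs ≤ a + b
grid-isometric-length≤ = isometric-length≤ grid-connected

remQuot-injective : ∀ k {x y : Fin (n * k)} → remQuot {n} k x ≡ remQuot k y → x ≡ y
remQuot-injective {n} k {x} {y} e =
  trans (sym (combine-remQuot {n} k x)) (trans (cong (uncurry combine) e) (combine-remQuot {n} k y))

few-short-paths-too-small : ∀ r′ t → suc t * t ≤ suc r′ →
                            m ≤ t → m * suc (r′ + t) < suc r′ * suc t
few-short-paths-too-small {m} r′ t st≤r m≤t = begin-strict
  m * suc (r′ + t)         ≤⟨ *-monoˡ-≤ (suc (r′ + t)) m≤t ⟩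
  t * suc (r′ + t)         ≡⟨ expand-left r′ t ⟩
  t * t + t * suc r′       <⟨ +-monoˡ-< (t * suc r′) (square<r t st≤r) ⟩
  suc r′ + t * suc r′      ≡⟨ expand-right r′ t ⟩
  suc r′ * suc t           ∎
  where
    open ≤-Reasoning
    expand-left : ∀ r′ t → t * suc (r′ + t) ≡ t * t + t * suc r′
    expand-left = solve-∀
    expand-right : ∀ r′ t → suc r′ + t * suc r′ ≡ suc r′ * suc t
    expand-right = solve-∀
    square<r : ∀ t → suc t * t ≤ suc r′ → t * t < suc r′
    square<r zero    _     = s≤s z≤n
    square<r (suc t) st≤r = <-≤-trans (m<n+m (suc t * suc t) (s≤s z≤n)) st≤r

corollary1 : (r s : ℕ) → 1 ≤ r → 1 ≤ s → s * (s ∸ 1) ≤ r →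
    ipc≡ (P r □ P s) s × ipp≡ (P r □ P s) s
corollary1 (suc r′) (suc t) _ _ st≤r = (cover , cover-minimal) , (partition , partition-minimal)
  where
    partition : HasIsoPartition (P (suc r′) □ P (suc t)) (suc t)
    partition = □P-rows (P-ascending-isometric (allFin-ascending (suc r′))) ∈-allFin

    cover : HasIsoCover (P (suc r′) □ P (suc t)) (suc t)
    cover = let F , covering , _ = partition in F , covering

    cover-minimal : ∀ m → HasIsoCover (P (suc r′) □ P (suc t)) m → suc t ≤ m
    cover-minimal m (F , covering) = ≰⇒> λ m≤t →
      <⇒≱ (few-short-paths-too-small r′ t st≤r m≤t)
          (cover-size F covering (λ i → grid-isometric-length≤ (iso F i))
                      (remQuot (suc t)) (remQuot-injective (suc t)))

    partition-minimal : ∀ m → HasIsoPartition (P (suc r′) □ P (suc t)) m → suc t ≤ m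
    partition-minimal m (F , covering , _) = cover-minimal m (F , covering)
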